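{- Let $L$ be a $\lambda$-theory. Then $H(L):=(\mathbf{Pshf}(L),L)$, where $L$ is the theory presheaf made reflexive via the exponential $L^L=A(L)$, $\mathrm{abs}=(\lambda_n)_n:A(L)\to L$ and $\mathrm{app}=(\rho_n)_n:L\to A(L)$, is an element of $\mathsf{RO}$, and $E(H(L))=L$ (an identity in the type of $\lambda$-theories). That is, $H$ is a right inverse of $E$: $E\circ H=\mathrm{id}_{\mathsf{LamTh}}$.
   Context: We work in univalent foundations. An algebraic theory $T$: sets $T_n$ ($n\in\mathbb N$), elements $x_{n,i}\in T_n$ ($1\le i\le n$), substitutions $\bullet:T_m\times T_n^m\to T_n$ with $x_j\bullet g=g_j$, $f\bullet(x_{l,i})_i=f$, $(f\bullet g)\bullet h=f\bullet(g_i\bullet h)_i$. Weakening $\iota_{m,n}(f)=f\bullet(x_{m+n,1},\dots,x_{m+n,m})$. A $\lambda$-theory is an algebraic theory $L$ with $\lambda_n:L_{n+1}\to L_n$, $\rho_n:L_n\to L_{n+1}$ such that $\lambda_m(f)\bullet h=\lambda_n(f\bullet(\iota_{n,1}(h_1),\dots,\iota_{n,1}(h_m),x_{n+1,n+1}))$ and $\rho_n(g\bullet h)=\rho_m(g)\bullet(\iota_{n,1}(h_1),\dots,\iota_{n,1}(h_m),x_{n+1,n+1})$ for $f\in L_{m+1},g\in L_m,h\in L_n^m$, and $\rho_n\circ\lambda_n=\mathrm{id}_{L_{n+1}}$. Morphisms of $\lambda$-theories are families of functions preserving variables, substitution, $\lambda$ and $\rho$; $\mathsf{LamTh}$ is the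 type of $\lambda$-theories. An $L$-presheaf $P$: sets $P_n$ with actions $\bullet:P_m\times L_n^m\to P_n$, $t\bullet(x_{l,i})_i=t$, $(t\bullet f)\bullet g=t\bullet(f_i\bullet g)_i$; morphisms are families $f_n:P_n\to Q_n$ with $f_n(t\bullet g)=f_m(t)\bullet g$; category $\mathbf{Pshf}(L)$, with terminal object the constant singleton presheaf and binary products computed componentwise. The theory presheaf $L$ has sets $L_n$ and action the substitution. $A(Q)_n=Q_{n+1}$ with action $q\bullet f=q\bullet(\iota_{n,1}(f_1),\dots,\iota_{n,1}(f_m),x_{n+1,n+1})$; $A(Q)$ is an exponential $Q^L$. For a category $\mathcal C$ with terminal object and binary products, a reflexive object is an object $X$ with an exponential $X^X$ and $\mathrm{app}:X\to X^X$, $\mathrm{abs}:X^X\to X$ with $\mathrm{app}\circ\mathrm{abs}=\mathrm{id}_{X^X}$; $\mathsf{RO}$ is the type of pairs of such a category and reflexive object. The endomorphism theory $E(\mathcal C,X)$ is the $\lambda$-theory with $E(X)_n=\mathcal C(X^n,X)$ ($X^0$ terminal, $X^{n+1}=X^n\times X$), variables the projections, substitution $f\bullet(g_1,\dots,g_m)=f\circ\langle g_1,\dots,g_m\rangle$, and, with $\varphi_Y:\mathcal C(Y\times X,X)\cong\mathcal C(Y,X^X)$ the currying bijection, $\lambda(f)=\mathrm{abs}\circ\varphi_{X^n}(f)$, $\rho(g)=\varphi_{X^n}^{ -1}(\mathrm{app}\circ g)$. This defines $E:\mathsf{RO}\to\mathsf{LamTh}$. -}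

module Defs where

open import Level using (Level; 0ℓ) renaming (suc to lsuc)
open import Data.Nat using (ℕ; zero; suc)
open import Data.Fin using (Fin; zero; suc; inject₁; fromℕ)
open import Data.Vec using (Vec; []; _∷_; lookup; tabulate; map; _∷ʳ_; init; last)
open import Data.Product using (_×_; _,_; proj₁; proj₂)
open import Data.Unit using (⊤; tt)
open import Relation.Binary.PropositionalEquality
  using (_≡_; refl; sym; trans; cong; cong₂; module ≡-Reasoning)

-- Conventions.  Tuples (h₁,…,hₘ) ∈ Lₙᵐ are vectors  Vec (T n) m.
-- Variable x_{n,i} (1 ≤ i ≤ n) is  var (i-1) : Fin n ;  x_{n+1,n+1} is
-- var (fromℕ n).  Appending at the end is  _∷ʳ_.

-- Raw λ-theories: the operations only (morphisms only refer to these).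

record RawLam : Set₁ where
  field
    T   : ℕ → Set
    var : ∀ {n} → Fin n → T n
    _•_ : ∀ {m n} → T m → Vec (T n) m → T n
    lam : ∀ {n} → T (suc n) → T n
    rho : ∀ {n} → T n → T (suc n)

  infixl 8 _•_

  vars : ∀ {n} → Vec (T n) n
  vars = tabulate var

  wk : ∀ {n} → Vec (T (suc n)) n
  wk = tabulate (λ i → var (inject₁ i))

  ι : ∀ {n} → T n → T (suc n)
  ι f = f • wk

  lift : ∀ {m n} → Vec (T n) m → Vec (T (suc n)) (suc m)
  lift {n = n} h = map ι h ∷ʳ var (fromℕ n)

record LamTh : Set₁ where
  field
    raw : RawLam
  open RawLam raw public
  field
    var-• : ∀ {m n} (j : Fin m) (g : Vec (T n) m) → var j • g ≡ lookup g j
    •-var : ∀ {m} (f : T m) → f • vars ≡ f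
    •-assoc : ∀ {l m n} (f : T l) (g : Vec (T m) l) (h : Vec (T n) m) →
              (f • g) • h ≡ f • map (_• h) g
    lam-• : ∀ {m n} (f : T (suc m)) (h : Vec (T n) m) → lam f • h ≡ lam (f • lift h)
    rho-• : ∀ {m n} (g : T m) (h : Vec (T n) m) → rho (g • h) ≡ rho g • lift h
    rho-lam : ∀ {n} (f : T (suc n)) → rho (lam f) ≡ f

record RawHom (A B : RawLam) : Set where
  private
    module A = RawLam A
    module B = RawLam B
  field
    fun      : ∀ {n} → A.T n → B.T n
    pres-var : ∀ {n} (i : Fin n) → fun (A.var i) ≡ B.var i
    pres-•   : ∀ {m n} (f : A.T m) (g : Vec (A.T n) m) → fun (f A.• g) ≡ fun f B.• map fun g
    pres-lam : ∀ {n} (f : A.T (suc n)) → fun (A.lam f) ≡ B.lam (fun f)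
    pres-rho : ∀ {n} (f : A.T n) → fun (A.rho f) ≡ B.rho (fun f)

record RawIso (A B : RawLam) : Set where
  field
    to   : RawHom A B
    from : RawHom B A
    from∘to : ∀ {n} (t : RawLam.T A n) → RawHom.fun from (RawHom.fun to t) ≡ t
    to∘from : ∀ {n} (t : RawLam.T B n) → RawHom.fun to (RawHom.fun from t) ≡ t

record CatData : Set₂ where
  field
    Obj : Set₁
    Hom : Obj → Obj → Set
    id  : ∀ {A} → Hom A A
    _∘_ : ∀ {A B C} → Hom B C → Hom A B → Hom A C
  infixr 9 _∘_

record IsCategory (C : CatData) : Set₁ where
  open CatData C
  field
    idˡ   : ∀ {A B} (f : Hom A B) → id ∘ f ≡ f
    idʳ   : ∀ {A B} (f : Hom A B) → f ∘ id ≡ f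
    assoc : ∀ {A B C D} (h : Hom C D) (g : Hom B C) (f : Hom A B) →
            (h ∘ g) ∘ f ≡ h ∘ (g ∘ f)

record TermData (C : CatData) : Set₁ where
  open CatData C
  field
    ⊤ₒ : Obj
    !  : ∀ A → Hom A ⊤ₒ

record IsTerminal (C : CatData) (T : TermData C) : Set₁ where
  open CatData C
  open TermData T
  field
    !-unique : ∀ {A} (f : Hom A ⊤ₒ) → f ≡ ! A

record ProdData (C : CatData) : Set₁ where
  open CatData C
  field
    _⊗_   : Obj → Obj → Obj
    π₁    : ∀ {A B} → Hom (A ⊗ B) A
    π₂    : ∀ {A B} → Hom (A ⊗ B) B
    ⟨_,_⟩ : ∀ {Y A B} → Hom Y A → Hom Y B → Hom Y (A ⊗ B)

  _⊗₁_ : ∀ {A A' B B'} → Hom A A' → Hom B B' → Hom (A ⊗ B) (A' ⊗ B')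
  f ⊗₁ g = ⟨ f ∘ π₁ , g ∘ π₂ ⟩

record IsProducts (C : CatData) (P : ProdData C) : Set₁ where
  open CatData C
  open ProdData P
  field
    β₁     : ∀ {Y A B} (f : Hom Y A) (g : Hom Y B) → π₁ ∘ ⟨ f , g ⟩ ≡ f
    β₂     : ∀ {Y A B} (f : Hom Y A) (g : Hom Y B) → π₂ ∘ ⟨ f , g ⟩ ≡ g
    unique : ∀ {Y A B} (f : Hom Y A) (g : Hom Y B) (h : Hom Y (A ⊗ B)) →
             π₁ ∘ h ≡ f → π₂ ∘ h ≡ g → h ≡ ⟨ f , g ⟩

record ExpData (C : CatData) (P : ProdData C) (A B : CatData.Obj C) : Set₁ where
  open CatData C
  open ProdData P
  field
    obj  : Obj
    eval : Hom (obj ⊗ A) B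

record IsExponential (C : CatData) (P : ProdData C) (A B : CatData.Obj C)
                     (E : ExpData C P A B) : Set₁ where
  open CatData C
  open ProdData P
  open ExpData E
  field
    curry  : ∀ {Y} → Hom (Y ⊗ A) B → Hom Y obj
    β      : ∀ {Y} (f : Hom (Y ⊗ A) B) → eval ∘ (curry f ⊗₁ id) ≡ f
    unique : ∀ {Y} (f : Hom (Y ⊗ A) B) (g : Hom Y obj) →
             eval ∘ (g ⊗₁ id) ≡ f → g ≡ curry f

record RO : Set₂ where
  field
    C     : CatData
    isCat : IsCategory C
    Tm    : TermData C
    isTm  : IsTerminal C Tm
    Pr    : ProdData C
    isPr  : IsProducts C Pr
    X     : CatData.Obj C
    Ex    : ExpData C Pr X X
    isEx  : IsExponential C Pr X X Ex
    app   : CatData.Hom C X (ExpData.obj Ex)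
    abs   : CatData.Hom C (ExpData.obj Ex) X
    app∘abs : CatData._∘_ C app abs ≡ CatData.id C

module EndoTheory (R : RO) where
  open RO R
  open CatData C
  open TermData Tm
  open ProdData Pr
  open ExpData Ex
  open IsExponential isEx

  pow : ℕ → Obj
  pow zero    = ⊤ₒ
  pow (suc n) = pow n ⊗ X

  projs : ∀ n → Vec (Hom (pow n) X) n
  projs zero    = []
  projs (suc n) = map (_∘ π₁) (projs n) ∷ʳ π₂

  tup : ∀ {Y} m → Vec (Hom Y X) m → Hom Y (pow m)
  tup {Y} zero    _  = ! Y
  tup     (suc m) gs = ⟨ tup m (init gs) , last gs ⟩

  E : RawLam
  E = record
    { T   = λ n → Hom (pow n) X
    ; var = λ {n} i → lookup (projs n) i
    ; _•_ = λ {m} f gs → f ∘ tup m gs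
    ; lam = λ f → abs ∘ curry f
    ; rho = λ g → eval ∘ ((app ∘ g) ⊗₁ id)      -- φ⁻¹(app ∘ g)
    }

E : RO → RawLam
E R = EndoTheory.E R

module _ (L : LamTh) where
  open LamTh L

  record Pshf : Set₁ where
    field
      P       : ℕ → Set
      act     : ∀ {m n} → P m → Vec (T n) m → P n
      act-var : ∀ {m} (t : P m) → act t vars ≡ t
      act-assoc : ∀ {l m n} (t : P l) (f : Vec (T m) l) (g : Vec (T n) m) →
                  act (act t f) g ≡ act t (map (_• g) f)

  record PHom (P Q : Pshf) : Set where
    private
      module P = Pshf P
      module Q = Pshf Q
    field
      fun : ∀ {n} → P.P n → Q.P n
      nat : ∀ {m n} (t : P.P m) (g : Vec (T n) m) → fun (P.act t g) ≡ Q.act (fun t) g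

module Presheaves (L : LamTh) where
  open LamTh L
  open Pshf
  open PHom

  PshCat : CatData
  PshCat = record
    { Obj = Pshf L
    ; Hom = PHom L
    ; id  = record { fun = λ t → t ; nat = λ t g → refl }
    ; _∘_ = λ {A} {B} {C} g f → record
        { fun = λ t → fun g (fun f t)
        ; nat = λ t h → trans (cong (fun g) (nat f t h)) (nat g (fun f t) h) }
    }

  ⊤P : Pshf L
  ⊤P = record { P = λ _ → ⊤ ; act = λ _ _ → tt ; act-var = λ _ → refl ; act-assoc = λ _ _ _ → refl }

  PshTerm : TermData PshCat
  PshTerm = record { ⊤ₒ = ⊤P ; ! = λ A → record { fun = λ _ → tt ; nat = λ _ _ → refl } }

  _×P_ : Pshf L → Pshf L → Pshf L
  A ×P B = record
    { P = λ n → P A n × P B n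
    ; act = λ t f → act A (proj₁ t) f , act B (proj₂ t) f
    ; act-var = λ t → cong₂ _,_ (act-var A (proj₁ t)) (act-var B (proj₂ t))
    ; act-assoc = λ t f g → cong₂ _,_ (act-assoc A (proj₁ t) f g) (act-assoc B (proj₂ t) f g)
    }

  PshProd : ProdData PshCat
  PshProd = record
    { _⊗_ = _×P_
    ; π₁ = record { fun = proj₁ ; nat = λ _ _ → refl }
    ; π₂ = record { fun = proj₂ ; nat = λ _ _ → refl }
    ; ⟨_,_⟩ = λ f g → record { fun = λ t → fun f t , fun g t
                             ; nat = λ t h → cong₂ _,_ (nat f t h) (nat g t h) }
    }

  private
    map-∷ʳ : ∀ {A B : Set} {k} (f : A → B) (xs : Vec A k) (x : A) →
             map f (xs ∷ʳ x) ≡ map f xs ∷ʳ f x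
    map-∷ʳ f []       x = refl
    map-∷ʳ f (y ∷ xs) x = cong (f y ∷_) (map-∷ʳ f xs x)

    map-tab : ∀ {A B : Set} {k} (f : A → B) (g : Fin k → A) →
              map f (tabulate g) ≡ tabulate (λ i → f (g i))
    map-tab {k = zero}  f g = refl
    map-tab {k = suc k} f g = cong (f (g zero) ∷_) (map-tab f (λ i → g (suc i)))

    tab-cong : ∀ {A : Set} {k} (f g : Fin k → A) → (∀ i → f i ≡ g i) →
               tabulate f ≡ tabulate g
    tab-cong {k = zero}  f g e = refl
    tab-cong {k = suc k} f g e = cong₂ _∷_ (e zero) (tab-cong _ _ (λ i → e (suc i)))

    tab-lookup : ∀ {A : Set} {k} (xs : Vec A k) → tabulate (lookup xs) ≡ xs
    tab-lookup []       = refl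
    tab-lookup (x ∷ xs) = cong (x ∷_) (tab-lookup xs)

    map-map : ∀ {A B C : Set} {k} (f : B → C) (g : A → B) (xs : Vec A k) →
              map f (map g xs) ≡ map (λ x → f (g x)) xs
    map-map f g []       = refl
    map-map f g (x ∷ xs) = cong (f (g x) ∷_) (map-map f g xs)

    map-cong′ : ∀ {A B : Set} {k} (f g : A → B) → (∀ x → f x ≡ g x) →
                (xs : Vec A k) → map f xs ≡ map g xs
    map-cong′ f g e []       = refl
    map-cong′ f g e (x ∷ xs) = cong₂ _∷_ (e x) (map-cong′ f g e xs)

    lookup-inj : ∀ {A : Set} {k} (xs : Vec A k) (x : A) (i : Fin k) →
                 lookup (xs ∷ʳ x) (inject₁ i) ≡ lookup xs i
    lookup-inj (y ∷ xs) x zero    = refl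
    lookup-inj (y ∷ xs) x (suc i) = lookup-inj xs x i

    lookup-last : ∀ {A : Set} {k} (xs : Vec A k) (x : A) →
                  lookup (xs ∷ʳ x) (fromℕ k) ≡ x
    lookup-last []       x = refl
    lookup-last (y ∷ xs) x = lookup-last xs x

    tab-snoc : ∀ {A : Set} k (f : Fin (suc k) → A) →
               tabulate (λ i → f (inject₁ i)) ∷ʳ f (fromℕ k) ≡ tabulate f
    tab-snoc zero    f = refl
    tab-snoc (suc k) f = cong (f zero ∷_) (tab-snoc k (λ i → f (suc i)))

    ι-snoc : ∀ {m n} (h : T m) (w : Vec (T n) m) (y : T n) → ι h • (w ∷ʳ y) ≡ h • w
    ι-snoc h w y = begin
        (h • wk) • (w ∷ʳ y)
      ≡⟨ •-assoc h wk (w ∷ʳ y) ⟩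
        h • map (_• (w ∷ʳ y)) wk
      ≡⟨ cong (h •_) (trans (map-tab (_• (w ∷ʳ y)) (λ i → var (inject₁ i)))
           (trans (tab-cong _ _ (λ i → trans (var-• (inject₁ i) (w ∷ʳ y)) (lookup-inj w y i)))
                  (tab-lookup w))) ⟩
        h • w
      ∎
      where open ≡-Reasoning

    ι• : ∀ {m n} (h : T m) (g : Vec (T n) m) → ι (h • g) ≡ h • map ι g
    ι• h g = •-assoc h g wk

    lookup-tab : ∀ {A : Set} {r} (F : Fin r → A) (j : Fin r) → lookup (tabulate F) j ≡ F j
    lookup-tab F zero    = refl
    lookup-tab F (suc j) = lookup-tab (λ i → F (suc i)) j

    map•lift : ∀ {l m n} (f : Vec (T m) l) (g : Vec (T n) m) →
               map (_• lift g) (lift f) ≡ lift (map (_• g) f)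
    map•lift {m = m} {n = n} f g = begin
        map (_• lift g) (map ι f ∷ʳ var (fromℕ m))
      ≡⟨ map-∷ʳ (_• lift g) (map ι f) (var (fromℕ m)) ⟩
        map (_• lift g) (map ι f) ∷ʳ (var (fromℕ m) • lift g)
      ≡⟨ cong₂ _∷ʳ_ (trans (map-map (_• lift g) ι f)
                      (trans (map-cong′ _ _ (λ h → trans (ι-snoc h (map ι g) (var (fromℕ n)))
                                                         (sym (ι• h g))) f)
                             (sym (map-map ι (_• g) f))))
                    (trans (var-• (fromℕ m) (lift g)) (lookup-last (map ι g) (var (fromℕ n)))) ⟩
        map ι (map (_• g) f) ∷ʳ var (fromℕ n)
      ∎
      where open ≡-Reasoning

    lift-vars : ∀ {m} → lift (vars {m}) ≡ vars
    lift-vars {m} = trans (cong (_∷ʳ var (fromℕ m))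
                             (trans (map-tab ι var)
                               (tab-cong _ _ (λ i → trans (var-• i wk)
                                 (lookup-tab (λ j → var (inject₁ j)) i)))))
                      (tab-snoc m var)

  A : Pshf L → Pshf L
  A Q = record
    { P = λ n → P Q (suc n)
    ; act = λ q f → act Q q (lift f)
    ; act-var = λ q → trans (cong (act Q q) lift-vars) (act-var Q q)
    ; act-assoc = λ q f g → trans (act-assoc Q q (lift f) (lift g)) (cong (act Q q) (map•lift f g))
    }

  ThP : Pshf L
  ThP = record { P = T ; act = _•_ ; act-var = •-var ; act-assoc = •-assoc }

  evalA : PHom L (A ThP ×P ThP) ThP
  evalA = record
    { fun = λ {n} t → proj₁ t • (vars ∷ʳ proj₂ t)
    ; nat = λ {m} {n} t g → nat-eval (proj₁ t) (proj₂ t) g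
    }
    where
      nat-eval : ∀ {m n} (q : T (suc m)) (f : T m) (g : Vec (T n) m) →
                 (q • lift g) • (vars ∷ʳ (f • g)) ≡ (q • (vars ∷ʳ f)) • g
      nat-eval {m} {n} q f g = begin
          (q • lift g) • (vars ∷ʳ (f • g))
        ≡⟨ •-assoc q (lift g) (vars ∷ʳ (f • g)) ⟩
          q • map (_• (vars ∷ʳ (f • g))) (map ι g ∷ʳ var (fromℕ n))
        ≡⟨ cong (q •_) (trans (map-∷ʳ _ (map ι g) (var (fromℕ n)))
             (cong₂ _∷ʳ_
               (trans (map-map _ ι g)
                 (trans (map-cong′ _ _ (λ h → trans (ι-snoc h vars (f • g)) (•-var h)) g)
                        (map-id g)))
               (trans (var-• (fromℕ n) _) (lookup-last vars (f • g))))) ⟩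
          q • (g ∷ʳ (f • g))
        ≡⟨ cong (λ v → q • (v ∷ʳ (f • g)))
             (sym (trans (map-tab (_• g) var)
                    (trans (tab-cong _ _ (λ i → var-• i g)) (tab-lookup g)))) ⟩
          q • (map (_• g) vars ∷ʳ (f • g))
        ≡⟨ cong (q •_) (sym (map-∷ʳ (_• g) vars f)) ⟩
          q • map (_• g) (vars ∷ʳ f)
        ≡⟨ sym (•-assoc q (vars ∷ʳ f) g) ⟩
          (q • (vars ∷ʳ f)) • g
        ∎
        where
          open ≡-Reasoning
          map-id : ∀ {A : Set} {k} (xs : Vec A k) → map (λ x → x) xs ≡ xs
          map-id []       = refl
          map-id (x ∷ xs) = cong (x ∷_) (map-id xs)

  PshExp : ExpData PshCat PshProd ThP ThP
  PshExp = record { obj = A ThP ; eval = evalA }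

  absL : PHom L (A ThP) ThP
  absL = record { fun = lam ; nat = λ f h → sym (lam-• f h) }

  appL : PHom L ThP (A ThP)
  appL = record { fun = rho ; nat = rho-• }

  H : IsCategory PshCat → IsTerminal PshCat PshTerm → IsProducts PshCat PshProd →
      IsExponential PshCat PshProd ThP ThP PshExp →
      CatData._∘_ PshCat appL absL ≡ CatData.id PshCat → RO
  H c t p e r = record
    { C = PshCat ; isCat = c ; Tm = PshTerm ; isTm = t ; Pr = PshProd ; isPr = p
    ; X = ThP ; Ex = PshExp ; isEx = e ; app = appL ; abs = absL ; app∘abs = r }

{-# OPTIONS --safe #-}
module Submission where

-- The n-th power of the theory presheaf L is representable: its elements at
-- stage k are n-tuples of k-ary terms, and the tuple of variables is a generic
-- element.  By the Yoneda lemma a presheaf morphism Lⁿ → L is determined by its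
-- value at the variables, so evaluation there is a bijection
-- E(H(L))ₙ = Pshf(L)(Lⁿ, L) ≅ Lₙ, and it commutes with variables, substitution,
-- λ and ρ; a bijective morphism of λ-theories is an isomorphism.  The
-- presheaf-level facts (category laws, products, the exponential A(L),
-- ρ ∘ λ = id) hold pointwise, and morphisms are compared by function
-- extensionality together with uniqueness of identity proofs for naturality.

open import Defs
open import Level using (0ℓ)
open import Data.Nat using (zero; suc)
open import Data.Fin using (Fin; zero; suc; inject₁; fromℕ)
open import Data.Vec using (Vec; []; _∷_; lookup; tabulate; map; _∷ʳ_; init; last; initLast)
open import Data.Vec.Properties
  using (map-∷ʳ; map-∘; map-cong; map-id; lookup-map; lookup∘tabulate; tabulate∘lookup;
         tabulate-∘; tabulate-cong)
open import Data.Product using (Σ; _,_; proj₂)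
open import Data.Unit using (tt)
open import Function using (_∘_)
open import Relation.Binary.PropositionalEquality
  using (_≡_; refl; sym; trans; cong; cong₂; module ≡-Reasoning)
open import Axiom.Extensionality.Propositional using (Extensionality; implicit-extensionality)
open import Axiom.UniquenessOfIdentityProofs.WithK using (uip)

open ≡-Reasoning

lookup-∷ʳ-inject₁ : ∀ {A : Set} {k} (xs : Vec A k) (x : A) (i : Fin k) →
                    lookup (xs ∷ʳ x) (inject₁ i) ≡ lookup xs i
lookup-∷ʳ-inject₁ (y ∷ xs) x zero    = refl
lookup-∷ʳ-inject₁ (y ∷ xs) x (suc i) = lookup-∷ʳ-inject₁ xs x i

lookup-∷ʳ-fromℕ : ∀ {A : Set} {k} (xs : Vec A k) (x : A) → lookup (xs ∷ʳ x) (fromℕ k) ≡ x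
lookup-∷ʳ-fromℕ []       x = refl
lookup-∷ʳ-fromℕ (y ∷ xs) x = lookup-∷ʳ-fromℕ xs x

tabulate-∷ʳ : ∀ {A : Set} k (f : Fin (suc k) → A) →
              tabulate (f ∘ inject₁) ∷ʳ f (fromℕ k) ≡ tabulate f
tabulate-∷ʳ zero    f = refl
tabulate-∷ʳ (suc k) f = cong (f zero ∷_) (tabulate-∷ʳ k (f ∘ suc))

init-∷ʳ-last : ∀ {A : Set} {k} (xs : Vec A (suc k)) → init xs ∷ʳ last xs ≡ xs
init-∷ʳ-last xs = sym (proj₂ (proj₂ (initLast xs)))

module RawHomInverse {A B : RawLam} (h : RawHom A B)
                     (h⁻¹ : ∀ {n} → RawLam.T B n → RawLam.T A n)
                     (h⁻¹∘h : ∀ {n} (t : RawLam.T A n) → h⁻¹ (RawHom.fun h t) ≡ t)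
                     (h∘h⁻¹ : ∀ {n} (t : RawLam.T B n) → RawHom.fun h (h⁻¹ t) ≡ t) where
  private
    module A = RawLam A
    module B = RawLam B
  open RawHom h

  fun-injective : ∀ {n} {s t : A.T n} → fun s ≡ fun t → s ≡ t
  fun-injective {s = s} {t} e = trans (sym (h⁻¹∘h s)) (trans (cong h⁻¹ e) (h⁻¹∘h t))

  map-h∘h⁻¹ : ∀ {m n} (gs : Vec (B.T n) m) → map fun (map h⁻¹ gs) ≡ gs
  map-h∘h⁻¹ gs = trans (sym (map-∘ fun h⁻¹ gs)) (trans (map-cong h∘h⁻¹ gs) (map-id gs))

  inverse : RawHom B A
  inverse = record
    { fun      = h⁻¹
    ; pres-var = λ i → fun-injective (trans (h∘h⁻¹ _) (sym (pres-var i)))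
    ; pres-•   = λ f gs → fun-injective (begin
        fun (h⁻¹ (f B.• gs))                   ≡⟨ h∘h⁻¹ _ ⟩
        f B.• gs                               ≡⟨ sym (cong₂ B._•_ (h∘h⁻¹ f) (map-h∘h⁻¹ gs)) ⟩
        fun (h⁻¹ f) B.• map fun (map h⁻¹ gs)   ≡⟨ sym (pres-• (h⁻¹ f) (map h⁻¹ gs)) ⟩
        fun (h⁻¹ f A.• map h⁻¹ gs)             ∎)
    ; pres-lam = λ f → fun-injective
        (trans (h∘h⁻¹ _) (sym (trans (pres-lam (h⁻¹ f)) (cong B.lam (h∘h⁻¹ f)))))
    ; pres-rho = λ f → fun-injective
        (trans (h∘h⁻¹ _) (sym (trans (pres-rho (h⁻¹ f)) (cong B.rho (h∘h⁻¹ f)))))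
    }

  iso : RawIso A B
  iso = record { to = h ; from = inverse ; from∘to = h⁻¹∘h ; to∘from = h∘h⁻¹ }

module Substitution (L : LamTh) where
  open LamTh L

  map-•-vars : ∀ {m n} (g : Vec (T n) m) → map (_• g) vars ≡ g
  map-•-vars g = begin
    map (_• g) vars            ≡⟨ sym (tabulate-∘ (_• g) var) ⟩
    tabulate (λ i → var i • g) ≡⟨ tabulate-cong (λ i → var-• i g) ⟩
    tabulate (lookup g)        ≡⟨ tabulate∘lookup g ⟩
    g                          ∎

  map-•-wk : ∀ {m n} (w : Vec (T n) m) (y : T n) → map (_• (w ∷ʳ y)) wk ≡ w
  map-•-wk w y = begin
    map (_• (w ∷ʳ y)) wk
      ≡⟨ sym (tabulate-∘ (_• (w ∷ʳ y)) (var ∘ inject₁)) ⟩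
    tabulate (λ i → var (inject₁ i) • (w ∷ʳ y))
      ≡⟨ tabulate-cong (λ i → trans (var-• (inject₁ i) _) (lookup-∷ʳ-inject₁ w y i)) ⟩
    tabulate (lookup w)
      ≡⟨ tabulate∘lookup w ⟩
    w ∎

  var-fromℕ-• : ∀ {m n} (w : Vec (T n) m) (y : T n) → var (fromℕ m) • (w ∷ʳ y) ≡ y
  var-fromℕ-• w y = trans (var-• _ _) (lookup-∷ʳ-fromℕ w y)

  ι-•-∷ʳ : ∀ {m n} (h : T m) (w : Vec (T n) m) (y : T n) → ι h • (w ∷ʳ y) ≡ h • w
  ι-•-∷ʳ h w y = trans (•-assoc h wk _) (cong (h •_) (map-•-wk w y))

  wk-∷ʳ-fresh : ∀ {n} → wk ∷ʳ var (fromℕ n) ≡ vars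
  wk-∷ʳ-fresh {n} = tabulate-∷ʳ n var

  map-•-lift : ∀ {l m n} (g : Vec (T m) l) (w : Vec (T n) m) (y : T n) →
               map (_• (w ∷ʳ y)) (lift g) ≡ map (_• w) g ∷ʳ y
  map-•-lift {m = m} g w y = begin
    map (_• (w ∷ʳ y)) (map ι g ∷ʳ var (fromℕ m))
      ≡⟨ map-∷ʳ _ _ (map ι g) ⟩
    map (_• (w ∷ʳ y)) (map ι g) ∷ʳ var (fromℕ m) • (w ∷ʳ y)
      ≡⟨ cong₂ _∷ʳ_ (trans (sym (map-∘ _ ι g)) (map-cong (λ h → ι-•-∷ʳ h w y) g))
                    (var-fromℕ-• w y) ⟩
    map (_• w) g ∷ʳ y ∎

  •-lift-wk-contract : ∀ {n} (q : T (suc n)) → (q • lift wk) • (vars ∷ʳ var (fromℕ n)) ≡ q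
  •-lift-wk-contract {n} q = begin
    (q • lift wk) • (vars ∷ʳ var (fromℕ n))       ≡⟨ •-assoc q _ _ ⟩
    q • map (_• (vars ∷ʳ var (fromℕ n))) (lift wk) ≡⟨ cong (q •_) (map-•-lift wk vars _) ⟩
    q • (map (_• vars) wk ∷ʳ var (fromℕ n))       ≡⟨ cong (λ v → q • (v ∷ʳ var (fromℕ n)))
                                                        (trans (map-cong •-var wk) (map-id wk)) ⟩
    q • (wk ∷ʳ var (fromℕ n))                     ≡⟨ cong (q •_) wk-∷ʳ-fresh ⟩
    q • vars                                      ≡⟨ •-var q ⟩
    q                                             ∎

  weaken-act : ∀ {m n} (Y : Pshf L) (y : Pshf.P Y m) (g : Vec (T n) m) →
               Pshf.act Y (Pshf.act Y y g) wk ≡ Pshf.act Y (Pshf.act Y y wk) (lift g)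
  weaken-act Y y g = begin
    Pshf.act Y (Pshf.act Y y g) wk             ≡⟨ Pshf.act-assoc Y y g wk ⟩
    Pshf.act Y y (map ι g)                     ≡⟨ cong (Pshf.act Y y) (sym (map-•-wk (map ι g) _)) ⟩
    Pshf.act Y y (map (_• lift g) wk)          ≡⟨ sym (Pshf.act-assoc Y y wk (lift g)) ⟩
    Pshf.act Y (Pshf.act Y y wk) (lift g)      ∎

module _ (ext : Extensionality 0ℓ 0ℓ) {L : LamTh} where
  open LamTh L using (T)
  open PHom

  PHom-ext : {P Q : Pshf L} {f g : PHom L P Q} →
             (∀ {n} (t : Pshf.P P n) → fun f t ≡ fun g t) → f ≡ g
  PHom-ext {P} {Q} {record { fun = f ; nat = ν }} {record { fun = g ; nat = μ }} e =
    same-fun (implicit-extensionality ext (ext e)) ν μ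
    where
    NatFor : (∀ {n} → Pshf.P P n → Pshf.P Q n) → Set
    NatFor f = ∀ {m n} (t : Pshf.P P m) (h : Vec (T n) m) →
               f (Pshf.act P t h) ≡ Pshf.act Q (f t) h

    same-fun : {f g : ∀ {n} → Pshf.P P n → Pshf.P Q n} → (λ {n} → f {n}) ≡ g →
               (ν : NatFor f) (μ : NatFor g) →
               _≡_ {A = PHom L P Q} record { fun = f ; nat = ν } record { fun = g ; nat = μ }
    same-fun {f} refl ν μ = cong (λ (ν : NatFor f) → record { fun = f ; nat = ν })
      (implicit-extensionality ext (implicit-extensionality ext
        (ext λ t → ext λ h → uip (ν t h) (μ t h))))

module TheoryPresheaf (ext : Extensionality 0ℓ 0ℓ) (L : LamTh) where
  open LamTh L
  open Presheaves L
  open Substitution L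
  open Pshf using (act; act-var; act-assoc)
  open PHom using (fun; nat)

  isCategory : IsCategory PshCat
  isCategory = record
    { idˡ   = λ _ → PHom-ext ext λ _ → refl
    ; idʳ   = λ _ → PHom-ext ext λ _ → refl
    ; assoc = λ _ _ _ → PHom-ext ext λ _ → refl
    }

  isTerminal : IsTerminal PshCat PshTerm
  isTerminal = record { !-unique = λ _ → PHom-ext ext λ _ → refl }

  isProducts : IsProducts PshCat PshProd
  isProducts = record
    { β₁     = λ _ _ → PHom-ext ext λ _ → refl
    ; β₂     = λ _ _ → PHom-ext ext λ _ → refl
    ; unique = λ f g h e₁ e₂ → PHom-ext ext λ t →
        cong₂ _,_ (cong (λ k → fun k t) e₁) (cong (λ k → fun k t) e₂)
    }

  curry : ∀ {Y} → PHom L (Y ×P ThP) ThP → PHom L Y (A ThP)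
  curry {Y} f = record { fun = curried ; nat = curried-nat }
    where
    curried : ∀ {n} → Pshf.P Y n → T (suc n)
    curried {n} y = fun f (act Y y wk , var (fromℕ n))

    curried-nat : ∀ {m n} (y : Pshf.P Y m) (g : Vec (T n) m) →
                  curried (act Y y g) ≡ curried y • lift g
    curried-nat {m} y g = begin
      fun f (act Y (act Y y g) wk , var (fromℕ _))
        ≡⟨ cong₂ (λ a b → fun f (a , b)) (weaken-act Y y g) (sym (var-fromℕ-• (map ι g) _)) ⟩
      fun f (act (Y ×P ThP) (act Y y wk , var (fromℕ m)) (lift g))
        ≡⟨ nat f _ (lift g) ⟩
      curried y • lift g ∎

  isExponential : IsExponential PshCat PshProd ThP ThP PshExp
  isExponential = record { curry = curry ; β = β ; unique = unique }
    where
    β : ∀ {Y} (f : PHom L (Y ×P ThP) ThP) →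
        CatData._∘_ PshCat evalA (ProdData._⊗₁_ PshProd (curry f) (CatData.id PshCat)) ≡ f
    β {Y} f = PHom-ext ext λ { {n} (y , t) → begin
      fun f (act Y y wk , var (fromℕ n)) • (vars ∷ʳ t)
        ≡⟨ sym (nat f _ (vars ∷ʳ t)) ⟩
      fun f (act Y (act Y y wk) (vars ∷ʳ t) , var (fromℕ n) • (vars ∷ʳ t))
        ≡⟨ cong₂ (λ a b → fun f (a , b))
             (trans (act-assoc Y y wk _) (trans (cong (act Y y) (map-•-wk vars t)) (act-var Y y)))
             (var-fromℕ-• vars t) ⟩
      fun f (y , t) ∎ }

    unique : ∀ {Y} (f : PHom L (Y ×P ThP) ThP) (g : PHom L Y (A ThP)) →
             CatData._∘_ PshCat evalA (ProdData._⊗₁_ PshProd g (CatData.id PshCat)) ≡ f →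
             g ≡ curry f
    unique {Y} f g e = PHom-ext ext λ {n} y → begin
      fun g y                                             ≡⟨ sym (•-lift-wk-contract _) ⟩
      (fun g y • lift wk) • (vars ∷ʳ var (fromℕ n))        ≡⟨ cong (_• _) (sym (nat g y wk)) ⟩
      fun g (act Y y wk) • (vars ∷ʳ var (fromℕ n))         ≡⟨ cong (λ k → fun k (act Y y wk , var (fromℕ n))) e ⟩
      fun f (act Y y wk , var (fromℕ n))                   ∎

  app∘abs : CatData._∘_ PshCat appL absL ≡ CatData.id PshCat
  app∘abs = PHom-ext ext rho-lam

  HL : RO
  HL = H isCategory isTerminal isProducts isExponential app∘abs

  open EndoTheory HL using (pow; projs; tup)

  toVec : ∀ n {k} → Pshf.P (pow n) k → Vec (T k) n
  toVec zero    _       = []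
  toVec (suc n) (p , x) = toVec n p ∷ʳ x

  toVec-act : ∀ n {k j} (p : Pshf.P (pow n) k) (g : Vec (T j) k) →
              toVec n (act (pow n) p g) ≡ map (_• g) (toVec n p)
  toVec-act zero    _       g = refl
  toVec-act (suc n) (p , x) g =
    trans (cong (_∷ʳ x • g) (toVec-act n p g)) (sym (map-∷ʳ (_• g) x (toVec n p)))

  -- The tuple of variables, built in the same way as curry builds its argument,
  -- so that λ is preserved definitionally.
  generic : ∀ n → Pshf.P (pow n) n
  generic zero    = tt
  generic (suc n) = act (pow n) (generic n) wk , var (fromℕ n)

  toVec-generic : ∀ n → toVec n (generic n) ≡ vars
  toVec-generic zero    = refl
  toVec-generic (suc n) = begin
    toVec n (act (pow n) (generic n) wk) ∷ʳ var (fromℕ n)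
      ≡⟨ cong (_∷ʳ var (fromℕ n)) (toVec-act n (generic n) wk) ⟩
    map (_• wk) (toVec n (generic n)) ∷ʳ var (fromℕ n)
      ≡⟨ cong (λ v → map (_• wk) v ∷ʳ var (fromℕ n)) (toVec-generic n) ⟩
    map (_• wk) vars ∷ʳ var (fromℕ n)
      ≡⟨ cong (_∷ʳ var (fromℕ n)) (map-•-vars wk) ⟩
    wk ∷ʳ var (fromℕ n)
      ≡⟨ wk-∷ʳ-fresh ⟩
    vars ∎

  act-generic : ∀ n {k} (p : Pshf.P (pow n) k) → act (pow n) (generic n) (toVec n p) ≡ p
  act-generic zero    tt      = refl
  act-generic (suc n) (p , x) = cong₂ _,_
    (begin
      act (pow n) (act (pow n) (generic n) wk) (toVec n p ∷ʳ x)
        ≡⟨ act-assoc (pow n) (generic n) wk _ ⟩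
      act (pow n) (generic n) (map (_• (toVec n p ∷ʳ x)) wk)
        ≡⟨ cong (act (pow n) (generic n)) (map-•-wk (toVec n p) x) ⟩
      act (pow n) (generic n) (toVec n p)
        ≡⟨ act-generic n p ⟩
      p ∎)
    (var-fromℕ-• (toVec n p) x)

  atGeneric : ∀ {n} {Q : Pshf L} → PHom L (pow n) Q → Pshf.P Q n
  atGeneric {n} φ = fun φ (generic n)

  yoneda : ∀ {n} {Q : Pshf L} → Pshf.P Q n → PHom L (pow n) Q
  yoneda {n} {Q} t = record
    { fun = λ p → act Q t (toVec n p)
    ; nat = λ p g → trans (cong (act Q t) (toVec-act n p g)) (sym (act-assoc Q t (toVec n p) g))
    }

  atGeneric-yoneda : ∀ {n} {Q : Pshf L} (t : Pshf.P Q n) → atGeneric (yoneda {Q = Q} t) ≡ t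
  atGeneric-yoneda {n} {Q} t = trans (cong (act Q t) (toVec-generic n)) (act-var Q t)

  yoneda-atGeneric : ∀ {n} {Q : Pshf L} (φ : PHom L (pow n) Q) → yoneda (atGeneric φ) ≡ φ
  yoneda-atGeneric {n} φ = PHom-ext ext λ p →
    trans (sym (nat φ (generic n) (toVec n p))) (cong (fun φ) (act-generic n p))

  map-fun-projs : ∀ n {k} (p : Pshf.P (pow n) k) → map (λ φ → fun φ p) (projs n) ≡ toVec n p
  map-fun-projs zero    _       = refl
  map-fun-projs (suc n) (p , x) = begin
    map (λ φ → fun φ (p , x)) (map (_∘P π₁) (projs n) ∷ʳ π₂)
      ≡⟨ map-∷ʳ _ π₂ (map (_∘P π₁) (projs n)) ⟩
    map (λ φ → fun φ (p , x)) (map (_∘P π₁) (projs n)) ∷ʳ x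
      ≡⟨ cong (_∷ʳ x) (trans (sym (map-∘ _ _ (projs n))) (map-fun-projs n p)) ⟩
    toVec n p ∷ʳ x ∎
    where
    open CatData PshCat using () renaming (_∘_ to _∘P_)
    open ProdData PshProd using (π₁; π₂)

  toVec-tup : ∀ m {n k} (gs : Vec (PHom L (pow n) ThP) m) (p : Pshf.P (pow n) k) →
              toVec m (fun (tup m gs) p) ≡ map (λ φ → fun φ p) gs
  toVec-tup zero    []  p = refl
  toVec-tup (suc m) {n} gs p = begin
    toVec m (fun (tup m (init gs)) p) ∷ʳ fun (last gs) p
      ≡⟨ cong (_∷ʳ fun (last gs) p) (toVec-tup m {n} (init gs) p) ⟩
    map (λ φ → fun φ p) (init gs) ∷ʳ fun (last gs) p
      ≡⟨ sym (map-∷ʳ _ (last gs) (init gs)) ⟩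
    map (λ φ → fun φ p) (init gs ∷ʳ last gs)
      ≡⟨ cong (map (λ φ → fun φ p)) (init-∷ʳ-last gs) ⟩
    map (λ φ → fun φ p) gs ∎

  tup-generic : ∀ m {n} (gs : Vec (PHom L (pow n) ThP) m) →
                fun (tup m gs) (generic n) ≡ act (pow m) (generic m) (map atGeneric gs)
  tup-generic m {n} gs = begin
    fun (tup m gs) (generic n)
      ≡⟨ sym (act-generic m _) ⟩
    act (pow m) (generic m) (toVec m (fun (tup m gs) (generic n)))
      ≡⟨ cong (act (pow m) (generic m)) (toVec-tup m {n} gs (generic n)) ⟩
    act (pow m) (generic m) (map atGeneric gs) ∎

  atGeneric-hom : RawHom (E HL) raw
  atGeneric-hom = record
    { fun      = atGeneric
    ; pres-var = pres-var
    ; pres-•   = pres-•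
    ; pres-lam = λ _ → refl
    ; pres-rho = pres-rho
    }
    where
    pres-var : ∀ {n} (i : Fin n) → atGeneric (lookup (projs n) i) ≡ var i
    pres-var {n} i = begin
      fun (lookup (projs n) i) (generic n)               ≡⟨ sym (lookup-map i _ (projs n)) ⟩
      lookup (map (λ φ → fun φ (generic n)) (projs n)) i  ≡⟨ cong (λ v → lookup v i) (map-fun-projs n (generic n)) ⟩
      lookup (toVec n (generic n)) i                     ≡⟨ cong (λ v → lookup v i) (toVec-generic n) ⟩
      lookup vars i                                      ≡⟨ lookup∘tabulate var i ⟩
      var i                                              ∎

    pres-• : ∀ {m n} (f : PHom L (pow m) ThP) (gs : Vec (PHom L (pow n) ThP) m) →
             fun f (fun (tup m gs) (generic n)) ≡ atGeneric f • map atGeneric gs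
    pres-• {m} f gs = trans (cong (fun f) (tup-generic m gs)) (nat f (generic m) (map atGeneric gs))

    -- ρ of E(H(L)) goes through the evaluation map of A(L), which identifies the
    -- last two variables.
    pres-rho : ∀ {n} (g : PHom L (pow n) ThP) →
               rho (fun g (act (pow n) (generic n) wk)) • (vars ∷ʳ var (fromℕ n)) ≡ rho (atGeneric g)
    pres-rho {n} g = begin
      rho (fun g (act (pow n) (generic n) wk)) • (vars ∷ʳ var (fromℕ n))
        ≡⟨ cong (λ t → rho t • (vars ∷ʳ var (fromℕ n))) (nat g (generic n) wk) ⟩
      rho (atGeneric g • wk) • (vars ∷ʳ var (fromℕ n))
        ≡⟨ cong (_• (vars ∷ʳ var (fromℕ n))) (rho-• (atGeneric g) wk) ⟩
      (rho (atGeneric g) • lift wk) • (vars ∷ʳ var (fromℕ n))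
        ≡⟨ •-lift-wk-contract (rho (atGeneric g)) ⟩
      rho (atGeneric g) ∎

  E-HL≅L : RawIso (E HL) raw
  E-HL≅L = RawHomInverse.iso atGeneric-hom yoneda (yoneda-atGeneric {Q = ThP}) (atGeneric-yoneda {Q = ThP})

theorem36 : Extensionality 0ℓ 0ℓ → (L : LamTh) →
    let open Presheaves L in
    Σ (IsCategory PshCat) λ c →
    Σ (IsTerminal PshCat PshTerm) λ t →
    Σ (IsProducts PshCat PshProd) λ p →
    Σ (IsExponential PshCat PshProd ThP ThP PshExp) λ e →
    Σ (CatData._∘_ PshCat appL absL ≡ CatData.id PshCat) λ r →
    RawIso (E (H c t p e r)) (LamTh.raw L)
theorem36 ext L = isCategory , isTerminal , isProducts , isExponential , app∘abs , E-HL≅L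
  where open TheoryPresheaf ext L
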